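{- Let $r,q,a$ be integers greater than $1$ such that $a$ divides $q-1$ and $(q-1)/a>1$. Then for every positive integer $m$ there exists a directed strongly regular graph with parameters \[\Big(\tfrac{mrq^2(q-1)}{a},\ mrq(q-1),\ m(rqa-ra+a),\ m\{q(a-1)+(r-1)(q-1)a\},\ m(rqa-ra+a)\Big).\]
   Context: A directed strongly regular graph with parameters $(v,k,t,\lambda,\mu)$ is a loopless directed graph on $v$ vertices with adjacency matrix $A$ satisfying $AJ=JA=kJ$ and $A^2=tI+\lambda A+\mu(J-I-A)$, where $I$ is the identity and $J$ the all-ones matrix. -}

module Defs where

open import Data.Nat using (ℕ; zero; suc; _+_; _*_)
open import Data.Bool using (Bool; true; false; _∧_)
open import Data.Fin using (Fin)
open import Data.Vec.Functional using (Vector; foldr)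
open import Relation.Binary.PropositionalEquality using (_≡_; _≢_)
open import Data.Product using (_×_)

∑ : ∀ {n} → (Fin n → ℕ) → ℕ
∑ f = foldr _+_ 0 f

⟦_⟧ : Bool → ℕ
⟦ true ⟧ = 1
⟦ false ⟧ = 0

Digraph : ℕ → Set
Digraph v = Fin v → Fin v → Bool

A[_] : ∀ {v} → Digraph v → Fin v → Fin v → ℕ
A[ A ] i j = ⟦ A i j ⟧

A²[_] : ∀ {v} → Digraph v → Fin v → Fin v → ℕ
A²[ A ] i j = ∑ (λ w → A[ A ] i w * A[ A ] w j)

-- Directed strongly regular graph with parameters (v,k,t,λ,μ):
-- loopless, AJ = JA = kJ, and A² = tI + λA + μ(J - I - A) entrywise.
-- The entrywise form of the last equation: on the diagonal (A_ii = 0) it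
-- reads (A²)_ii = t; off the diagonal it reads (A²)_ij = λ A_ij + μ (1 - A_ij).
record IsDSRG (v k t λ' μ : ℕ) (A : Digraph v) : Set where
  field
    loopless  : ∀ i → A i i ≡ false
    rowSum    : ∀ i → ∑ (λ j → A[ A ] i j) ≡ k
    colSum    : ∀ j → ∑ (λ i → A[ A ] i j) ≡ k
    diag      : ∀ i → A²[ A ] i i ≡ t
    adjacent  : ∀ i j → i ≢ j → A i j ≡ true  → A²[ A ] i j ≡ λ'
    nonadj    : ∀ i j → i ≢ j → A i j ≡ false → A²[ A ] i j ≡ μ

-- Write q − 1 = b a.  The seed graph has vertices (g, p, y, j) with a layer g < r,
-- p, j ∈ ℤ/q and a block index y < b.  Inside a layer, (g,p,y,j) → (g,p',y',j') iff
-- p − p' − 1 (mod q) lies in the y'-th block {y'a, …, y'a + a − 1} of ℤ/q ∖ {−1};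
-- between different layers, (g,p,y,j) → (g',p',y',j') iff p + j' (mod q) < a.
-- Calling X and Z these two kinds of blocks, one checks XX + qX = XZ + qZ = qa·J and
-- ZX = ZZ = ba²·J, so the seed adjacency matrix A satisfies A² + qA = μJ with
-- μ = qa + (r−1)ba², it is loopless and every vertex has in- and out-degree rq(q−1).
-- Such a "seed" is a DSRG with t = μ and λ = μ − q, and its m-fold blow-up A ⊗ J_m is a
-- DSRG with all parameters multiplied by m.
module Submission where

open import Data.Bool using (Bool; true; false; not)
open import Data.Bool.Properties using (T-≡; ¬-not)
open import Data.Empty using (⊥-elim)
open import Data.Fin using (Fin; toℕ)
open import Data.Nat
open import Data.Nat.DivMod
open import Data.Nat.Divisibility using (_∣_; divides; divides-refl)
open import Data.Nat.Properties
open import Data.Nat.Tactic.RingSolver using (solve-∀)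
open import Data.Product using (Σ; _,_)
open import Function.Bundles using (Equivalence)
open import Relation.Binary.Definitions using (tri<; tri≈; tri>)
open import Relation.Binary.PropositionalEquality
open import Relation.Nullary using (yes; no)
open import Defs

open ≡-Reasoning

≡ᵇ-refl : ∀ n → (n ≡ᵇ n) ≡ true
≡ᵇ-refl n = Equivalence.to T-≡ (≡⇒≡ᵇ n n refl)

≢⇒≡ᵇ-false : ∀ {m n} → m ≢ n → (m ≡ᵇ n) ≡ false
≢⇒≡ᵇ-false {m} {n} m≢n = ¬-not (λ e → m≢n (≡ᵇ⇒≡ m n (Equivalence.from T-≡ e)))

≡ᵇ-sym : ∀ m n → (m ≡ᵇ n) ≡ (n ≡ᵇ m)
≡ᵇ-sym m n with m ≟ n
... | yes refl = refl
... | no m≢n = trans (≢⇒≡ᵇ-false m≢n) (sym (≢⇒≡ᵇ-false (λ e → m≢n (sym e))))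

<⇒<ᵇ-true : ∀ {m n} → m < n → (m <ᵇ n) ≡ true
<⇒<ᵇ-true m<n = Equivalence.to T-≡ (<⇒<ᵇ m<n)

≥⇒<ᵇ-false : ∀ {m n} → n ≤ m → (m <ᵇ n) ≡ false
≥⇒<ᵇ-false {m} {n} n≤m = ¬-not (λ e → ≤⇒≯ n≤m (<ᵇ⇒< m n (Equivalence.from T-≡ e)))

-- sumTo n f = Σ_{x<n} f x.  Indexing by ℕ (rather than Fin) lets div/mod arithmetic
-- reorganise sums; the only facts about f used are its values below n.
sumTo : ℕ → (ℕ → ℕ) → ℕ
sumTo zero    f = 0
sumTo (suc n) f = f 0 + sumTo n (λ x → f (suc x))

∑-toℕ : ∀ n (f : ℕ → ℕ) → ∑ {n} (λ i → f (toℕ i)) ≡ sumTo n f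
∑-toℕ zero    f = refl
∑-toℕ (suc n) f = cong (f 0 +_) (∑-toℕ n (λ x → f (suc x)))

sumTo-cong< : ∀ n {f g : ℕ → ℕ} → (∀ x → x < n → f x ≡ g x) → sumTo n f ≡ sumTo n g
sumTo-cong< zero    f≡g = refl
sumTo-cong< (suc n) f≡g =
  cong₂ _+_ (f≡g 0 z<s) (sumTo-cong< n (λ x x<n → f≡g (suc x) (s<s x<n)))

sumTo-cong : ∀ n {f g : ℕ → ℕ} → (∀ x → f x ≡ g x) → sumTo n f ≡ sumTo n g
sumTo-cong n f≡g = sumTo-cong< n (λ x _ → f≡g x)

sumTo-const : ∀ n c → sumTo n (λ _ → c) ≡ n * c
sumTo-const zero    c = refl
sumTo-const (suc n) c = cong (c +_) (sumTo-const n c)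

sumTo-*ˡ : ∀ n c f → sumTo n (λ x → c * f x) ≡ c * sumTo n f
sumTo-*ˡ zero    c f = sym (*-zeroʳ c)
sumTo-*ˡ (suc n) c f =
  trans (cong (c * f 0 +_) (sumTo-*ˡ n c (λ x → f (suc x)))) (sym (*-distribˡ-+ c (f 0) _))

sumTo-*ʳ : ∀ n c f → sumTo n (λ x → f x * c) ≡ sumTo n f * c
sumTo-*ʳ n c f = trans (sumTo-cong n (λ x → *-comm (f x) c)) (trans (sumTo-*ˡ n c f) (*-comm c _))

sumTo-++ : ∀ m n f → sumTo (m + n) f ≡ sumTo m f + sumTo n (λ x → f (m + x))
sumTo-++ zero    n f = refl
sumTo-++ (suc m) n f =
  trans (cong (f 0 +_) (sumTo-++ m n (λ x → f (suc x)))) (sym (+-assoc (f 0) _ _))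

sumTo-snoc : ∀ n f → sumTo (suc n) f ≡ sumTo n f + f n
sumTo-snoc zero    f = +-comm (f 0) 0
sumTo-snoc (suc n) f =
  trans (cong (f 0 +_) (sumTo-snoc n (λ x → f (suc x)))) (sym (+-assoc (f 0) _ _))

sumTo-shift : ∀ n f → f n ≡ f 0 → sumTo n (λ x → f (suc x)) ≡ sumTo n f
sumTo-shift n f fn≡f0 = +-cancelˡ-≡ (f 0) _ _ (begin
  f 0 + sumTo n (λ x → f (suc x)) ≡⟨ sumTo-snoc n f ⟩
  sumTo n f + f n                 ≡⟨ cong (sumTo n f +_) fn≡f0 ⟩
  sumTo n f + f 0                 ≡⟨ +-comm (sumTo n f) (f 0) ⟩
  f 0 + sumTo n f                 ∎)

sumTo-rotate : ∀ q .{{_ : NonZero q}} c (h : ℕ → ℕ) → sumTo q (λ x → h ((x + c) % q)) ≡ sumTo q h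
sumTo-rotate q zero h =
  sumTo-cong< q (λ x x<q → cong h (trans (cong (_% q) (+-identityʳ x)) (m<n⇒m%n≡m x<q)))
sumTo-rotate q (suc c) h = begin
  sumTo q (λ x → h ((x + suc c) % q)) ≡⟨ sumTo-cong q (λ x → cong (λ z → h (z % q)) (+-suc x c)) ⟩
  sumTo q (λ x → H (suc x))           ≡⟨ sumTo-shift q H (cong h (trans (cong (_% q) (+-comm q c)) ([m+n]%n≡m%n c q))) ⟩
  sumTo q H                           ≡⟨ sumTo-rotate q c h ⟩
  sumTo q h                           ∎
  where
  H : ℕ → ℕ
  H y = h ((y + c) % q)

sumTo-blocks : ∀ n k (F : ℕ → ℕ) → sumTo (n * k) F ≡ sumTo n (λ i → sumTo k (λ j → F (j + i * k)))
sumTo-blocks zero    k F = refl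
sumTo-blocks (suc n) k F = begin
  sumTo (k + n * k) F
    ≡⟨ sumTo-++ k (n * k) F ⟩
  sumTo k F + sumTo (n * k) (λ x → F (k + x))
    ≡⟨ cong₂ _+_ (sumTo-cong k (λ j → cong F (sym (+-identityʳ j))))
                 (trans (sumTo-blocks n k (λ x → F (k + x)))
                        (sumTo-cong n (λ i → sumTo-cong k (λ j → cong F (+-shuffle k j (i * k)))))) ⟩
  sumTo k (λ j → F (j + 0)) + sumTo n (λ i → sumTo k (λ j → F (j + (k + i * k)))) ∎
  where
  +-shuffle : ∀ x y z → x + (y + z) ≡ y + (x + z)
  +-shuffle = solve-∀

[j+ik]/k≡i : ∀ i j k .{{_ : NonZero k}} → j < k → (j + i * k) / k ≡ i
[j+ik]/k≡i i j k j<k =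
  trans (+-distrib-/-∣ʳ j (divides-refl i)) (cong₂ _+_ (m<n⇒m/n≡0 j<k) (m*n/n≡m i k))

[j+ik]%k≡j : ∀ i j k .{{_ : NonZero k}} → j < k → (j + i * k) % k ≡ j
[j+ik]%k≡j i j k j<k = trans ([m+kn]%n≡m%n j i k) (m<n⇒m%n≡m j<k)

sumTo-divmod : ∀ n k .{{_ : NonZero k}} (G : ℕ → ℕ → ℕ) →
               sumTo (n * k) (λ x → G (x / k) (x % k)) ≡ sumTo n (λ i → sumTo k (λ j → G i j))
sumTo-divmod n k G = trans (sumTo-blocks n k _)
  (sumTo-cong n (λ i → sumTo-cong< k (λ j j<k → cong₂ G ([j+ik]/k≡i i j k j<k) ([j+ik]%k≡j i j k j<k))))

sumTo-replace : ∀ n c (f g : ℕ → ℕ) → c < n → (∀ x → x < n → x ≢ c → f x ≡ g x) →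
                sumTo n f + g c ≡ sumTo n g + f c
sumTo-replace (suc n) zero f g _ f≡g = begin
  f 0 + sumTo n (λ x → f (suc x)) + g 0
    ≡⟨ cong (λ s → f 0 + s + g 0) (sumTo-cong< n (λ x x<n → f≡g (suc x) (s<s x<n) (λ ()))) ⟩
  f 0 + sumTo n (λ x → g (suc x)) + g 0
    ≡⟨ swap-ends (f 0) _ (g 0) ⟩
  g 0 + sumTo n (λ x → g (suc x)) + f 0 ∎
  where
  swap-ends : ∀ x y z → x + y + z ≡ z + y + x
  swap-ends = solve-∀
sumTo-replace (suc n) (suc c) f g (s<s c<n) f≡g = begin
  f 0 + sumTo n (λ x → f (suc x)) + g (suc c)
    ≡⟨ +-assoc (f 0) _ _ ⟩
  f 0 + (sumTo n (λ x → f (suc x)) + g (suc c))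
    ≡⟨ cong₂ _+_ (f≡g 0 z<s (λ ()))
                 (sumTo-replace n c (λ x → f (suc x)) (λ x → g (suc x)) c<n
                   (λ x x<n x≢c → f≡g (suc x) (s<s x<n) (λ e → x≢c (suc-injective e)))) ⟩
  g 0 + (sumTo n (λ x → g (suc x)) + f (suc c))
    ≡⟨ sym (+-assoc (g 0) _ _) ⟩
  g 0 + sumTo n (λ x → g (suc x)) + f (suc c) ∎

sumTo-indicator : ∀ n c (h : Bool → ℕ) → c < n →
                  sumTo n (λ x → h (c ≡ᵇ x)) + h false ≡ n * h false + h true
sumTo-indicator n c h c<n =
  trans (sumTo-replace n c _ (λ _ → h false) c<n (λ x _ x≢c → cong h (≢⇒≡ᵇ-false (λ e → x≢c (sym e)))))
        (cong₂ _+_ (sumTo-const n (h false)) (cong h (≡ᵇ-refl c)))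

sumTo-omit : ∀ n c (Φ : ℕ → ℕ) → c < n → sumTo n (λ x → ⟦ not (c ≡ᵇ x) ⟧ * Φ x) + Φ c ≡ sumTo n Φ
sumTo-omit n c Φ c<n = begin
  sumTo n (λ x → ⟦ not (c ≡ᵇ x) ⟧ * Φ x) + Φ c
    ≡⟨ sumTo-replace n c _ Φ c<n off-c ⟩
  sumTo n Φ + ⟦ not (c ≡ᵇ c) ⟧ * Φ c
    ≡⟨ cong (λ s → sumTo n Φ + ⟦ not s ⟧ * Φ c) (≡ᵇ-refl c) ⟩
  sumTo n Φ + 0
    ≡⟨ +-identityʳ _ ⟩
  sumTo n Φ ∎
  where
  off-c : ∀ x → x < n → x ≢ c → ⟦ not (c ≡ᵇ x) ⟧ * Φ x ≡ Φ x
  off-c x _ x≢c = trans (cong (λ s → ⟦ not s ⟧ * Φ x) (≢⇒≡ᵇ-false (λ e → x≢c (sym e)))) (+-identityʳ (Φ x))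

-- For an (n+1)×(n+1) block matrix with diagonal blocks B_true
-- and off-diagonal blocks B_false, the (c,d) block of its square is
-- Σ_x F(c = x, x = d) with F s t = B_s B_t.
layerSum-same : ∀ n c (F : Bool → Bool → ℕ) → c < suc n →
                sumTo (suc n) (λ x → F (c ≡ᵇ x) (x ≡ᵇ c)) ≡ F true true + n * F false false
layerSum-same n c F c<n = +-cancelʳ-≡ (F false false) _ _ (begin
  sumTo (suc n) (λ x → F (c ≡ᵇ x) (x ≡ᵇ c)) + F false false
    ≡⟨ cong (_+ F false false) (sumTo-cong (suc n) (λ x → cong (F (c ≡ᵇ x)) (≡ᵇ-sym x c))) ⟩
  sumTo (suc n) (λ x → F (c ≡ᵇ x) (c ≡ᵇ x)) + F false false
    ≡⟨ sumTo-indicator (suc n) c (λ s → F s s) c<n ⟩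
  suc n * F false false + F true true
    ≡⟨ rearrange n (F false false) (F true true) ⟩
  F true true + n * F false false + F false false ∎)
  where
  rearrange : ∀ n x y → suc n * x + y ≡ y + n * x + x
  rearrange = solve-∀

layerSum-other : ∀ n c d (F : Bool → Bool → ℕ) → c < suc n → d < suc n → c ≢ d →
                 sumTo (suc n) (λ x → F (c ≡ᵇ x) (x ≡ᵇ d)) + F false false
                   ≡ F true false + F false true + n * F false false
layerSum-other n c d F c<n d<n c≢d = +-cancelʳ-≡ (F false false) _ _ (begin
  sumTo (suc n) f + F false false + F false false
    ≡⟨ cong (_+ F false false) replace-at-d ⟩
  sumTo (suc n) f' + F false true + F false false
    ≡⟨ +-right-comm (sumTo (suc n) f') (F false true) (F false false) ⟩
  sumTo (suc n) f' + F false false + F false true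
    ≡⟨ cong (_+ F false true) (sumTo-indicator (suc n) c (λ s → F s false) c<n) ⟩
  suc n * F false false + F true false + F false true
    ≡⟨ rearrange n (F false false) (F true false) (F false true) ⟩
  F true false + F false true + n * F false false + F false false ∎)
  where
  f f' : ℕ → ℕ
  f  x = F (c ≡ᵇ x) (x ≡ᵇ d)
  f' x = F (c ≡ᵇ x) false
  c≡ᵇd : (c ≡ᵇ d) ≡ false
  c≡ᵇd = ≢⇒≡ᵇ-false c≢d
  replace-at-d : sumTo (suc n) f + F false false ≡ sumTo (suc n) f' + F false true
  replace-at-d = subst₂ (λ u v → sumTo (suc n) f + u ≡ sumTo (suc n) f' + v)
    (cong (λ s → F s false) c≡ᵇd) (cong₂ F c≡ᵇd (≡ᵇ-refl d))
    (sumTo-replace (suc n) d f f' d<n (λ x _ x≢d → cong (F (c ≡ᵇ x)) (≢⇒≡ᵇ-false x≢d)))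
  +-right-comm : ∀ x y z → x + y + z ≡ x + z + y
  +-right-comm = solve-∀
  rearrange : ∀ n x y z → suc n * x + y + z ≡ y + z + n * x + x
  rearrange = solve-∀

count-≡ᵇ : ∀ n k → sumTo n (λ y → ⟦ k ≡ᵇ y ⟧) ≡ ⟦ k <ᵇ n ⟧
count-≡ᵇ zero    k       = refl
count-≡ᵇ (suc n) zero    = cong suc (trans (sumTo-const n 0) (*-zeroʳ n))
count-≡ᵇ (suc n) (suc k) = count-≡ᵇ n k

count-<ᵇ : ∀ n a → a ≤ n → sumTo n (λ z → ⟦ z <ᵇ a ⟧) ≡ a
count-<ᵇ n zero _ =
  trans (sumTo-cong n (λ z → cong ⟦_⟧ (≥⇒<ᵇ-false {z} z≤n))) (trans (sumTo-const n 0) (*-zeroʳ n))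
count-<ᵇ (suc n) (suc a) (s≤s a≤n) = cong suc (count-<ᵇ n a a≤n)

-- Among z ≤ b a, exactly a have quotient y by a, for every y < b (the value z = b a
-- has quotient b and is never counted).
count-quotient : ∀ b a .{{_ : NonZero a}} y → y < b → sumTo (suc (b * a)) (λ z → ⟦ z / a ≡ᵇ y ⟧) ≡ a
count-quotient b a y y<b = begin
  sumTo (suc (b * a)) f
    ≡⟨ sumTo-snoc (b * a) f ⟩
  sumTo (b * a) f + f (b * a)
    ≡⟨ cong₂ _+_ (sumTo-divmod b a (λ i _ → ⟦ i ≡ᵇ y ⟧)) (cong (λ z → ⟦ z ≡ᵇ y ⟧) (m*n/n≡m b a)) ⟩
  sumTo b (λ i → sumTo a (λ _ → ⟦ i ≡ᵇ y ⟧)) + ⟦ b ≡ᵇ y ⟧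
    ≡⟨ cong₂ _+_ (sumTo-cong b (λ i → trans (sumTo-const a _) (cong (λ s → a * ⟦ s ⟧) (≡ᵇ-sym i y))))
                 (cong ⟦_⟧ (≢⇒≡ᵇ-false (λ e → <-irrefl (sym e) y<b))) ⟩
  sumTo b (λ i → a * ⟦ y ≡ᵇ i ⟧) + 0
    ≡⟨ trans (+-identityʳ _) (sumTo-*ˡ b a _) ⟩
  a * sumTo b (λ i → ⟦ y ≡ᵇ i ⟧)
    ≡⟨ cong (a *_) (trans (count-≡ᵇ b y) (cong ⟦_⟧ (<⇒<ᵇ-true y<b))) ⟩
  a * 1
    ≡⟨ *-identityʳ a ⟩
  a ∎
  where
  f : ℕ → ℕ
  f z = ⟦ z / a ≡ᵇ y ⟧

count-others : ∀ n c → c < n → sumTo n (λ x → ⟦ not (c ≡ᵇ x) ⟧) + 1 ≡ n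
count-others n c c<n =
  trans (sumTo-indicator n c (λ s → ⟦ not s ⟧) c<n) (trans (+-identityʳ (n * 1)) (*-identityʳ n))

-- In ℤ/(n+1) the residue p + (n − p') ≡ p − p' − 1 equals n (i.e. −1) exactly when p = p'.
cyclic-gap-self : ∀ n p → p < suc n → (p + (n ∸ p)) % suc n ≡ n
cyclic-gap-self n p (s≤s p≤n) = trans (cong (_% suc n) (m+[n∸m]≡n p≤n)) (m≤n⇒m%n≡m ≤-refl)

cyclic-gap-other : ∀ n p p' → p < suc n → p' < suc n → p ≢ p' → (p + (n ∸ p')) % suc n < n
cyclic-gap-other n p p' (s≤s p≤n) (s≤s p'≤n) p≢p' with <-cmp p p'
... | tri≈ _ p≡p' _ = ⊥-elim (p≢p' p≡p')
... | tri< p<p' _ _ = subst (_< n) (sym (m≤n⇒m%n≡m (<⇒≤ gap<n))) gap<n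
  where
  gap<n : p + (n ∸ p') < n
  gap<n = subst (p + (n ∸ p') <_) (m+[n∸m]≡n p'≤n) (+-monoˡ-< (n ∸ p') p<p')
... | tri> _ _ p'<p = subst (_< n) (sym gap≡e) e<n
  where
  e = p ∸ suc p'
  p≡ : suc p' + e ≡ p
  p≡ = m+[n∸m]≡n p'<p
  gap≡e+[n+1] : p + (n ∸ p') ≡ e + suc n
  gap≡e+[n+1] = begin
    p + (n ∸ p')                   ≡⟨ cong (_+ (n ∸ p')) (sym p≡) ⟩
    suc p' + e + (n ∸ p')          ≡⟨ regroup p' e (n ∸ p') ⟩
    e + suc (p' + (n ∸ p'))        ≡⟨ cong (λ z → e + suc z) (m+[n∸m]≡n p'≤n) ⟩
    e + suc n                      ∎
    where
    regroup : ∀ x y z → suc x + y + z ≡ y + suc (x + z)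
    regroup = solve-∀
  e<n : e < n
  e<n = ≤-trans (subst (e <_) (trans (+-comm e (suc p')) p≡) (m<m+n e z<s)) p≤n
  gap≡e : (p + (n ∸ p')) % suc n ≡ e
  gap≡e = trans (cong (_% suc n) gap≡e+[n+1]) (trans ([m+n]%n≡m%n e (suc n)) (m≤n⇒m%n≡m (<⇒≤ e<n)))

-- A seed: a loopless digraph on {0,…,K−1} with all in- and out-degrees k and A² + cA = μJ.
-- Its diagonal then reads (A²)_uu = μ, so a seed is itself a DSRG(K, k, μ, μ − c, μ).
record IsSeed (K k c μ : ℕ) (adj : ℕ → ℕ → Bool) : Set where
  field
    loopless  : ∀ u → u < K → adj u u ≡ false
    outDegree : ∀ u → u < K → sumTo K (λ v → ⟦ adj u v ⟧) ≡ k
    inDegree  : ∀ v → v < K → sumTo K (λ u → ⟦ adj u v ⟧) ≡ k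
    square    : ∀ u w → u < K → w < K →
                sumTo K (λ v → ⟦ adj u v ⟧ * ⟦ adj v w ⟧) + c * ⟦ adj u w ⟧ ≡ μ

-- The m-fold blow-up A ⊗ J_m: vertex i of Fin (m K) behaves as vertex i mod K of the seed.
blowUp : ∀ m K .{{_ : NonZero K}} → (ℕ → ℕ → Bool) → Digraph (m * K)
blowUp m K adj i j = adj (toℕ i % K) (toℕ j % K)

∑-mod : ∀ m K .{{_ : NonZero K}} (H : ℕ → ℕ) → ∑ {m * K} (λ i → H (toℕ i % K)) ≡ m * sumTo K H
∑-mod m K H = trans (∑-toℕ (m * K) (λ x → H (x % K)))
                    (trans (sumTo-divmod m K (λ _ u → H u)) (sumTo-const m (sumTo K H)))

-- The blow-up of a seed is a DSRG(mK, mk, mμ, mλ, mμ) where λ = μ − c: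
-- (A ⊗ J_m)² = A² ⊗ mJ = m(μJ − c(A ⊗ J_m)).
blowUp-isDSRG : ∀ {K k c μ λ'} .{{_ : NonZero K}} {adj : ℕ → ℕ → Bool} →
                IsSeed K k c μ adj → λ' + c ≡ μ → ∀ m →
                IsDSRG (m * K) (m * k) (m * μ) (m * λ') (m * μ) (blowUp m K adj)
blowUp-isDSRG {K} {_} {c} {μ} {λ'} {adj} seed λ'+c≡μ m = record
  { loopless = λ i → loopless (res i) (res< i)
  ; rowSum   = λ i → trans (∑-mod m K (λ v → ⟦ adj (res i) v ⟧)) (cong (m *_) (outDegree (res i) (res< i)))
  ; colSum   = λ j → trans (∑-mod m K (λ u → ⟦ adj u (res j) ⟧)) (cong (m *_) (inDegree (res j) (res< j)))
  ; diag     = λ i → nonadjacent i i (loopless (res i) (res< i))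
  ; adjacent = λ i j _ → adjacent i j
  ; nonadj   = λ i j _ → nonadjacent i j
  }
  where
  open IsSeed seed
  res : Fin (m * K) → ℕ
  res i = toℕ i % K
  res< : ∀ i → res i < K
  res< i = m%n<n (toℕ i) K
  walks : Fin (m * K) → Fin (m * K) → ℕ
  walks i j = sumTo K (λ v → ⟦ adj (res i) v ⟧ * ⟦ adj v (res j) ⟧)
  A²≡m*walks : ∀ i j → A²[ blowUp m K adj ] i j ≡ m * walks i j
  A²≡m*walks i j = ∑-mod m K (λ v → ⟦ adj (res i) v ⟧ * ⟦ adj v (res j) ⟧)
  square-at : ∀ i j → walks i j + c * ⟦ adj (res i) (res j) ⟧ ≡ μ
  square-at i j = square (res i) (res j) (res< i) (res< j)
  nonadjacent : ∀ i j → adj (res i) (res j) ≡ false → A²[ blowUp m K adj ] i j ≡ m * μ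
  nonadjacent i j e = trans (A²≡m*walks i j) (cong (m *_) (begin
    walks i j                                ≡⟨ sym (+-identityʳ _) ⟩
    walks i j + 0                            ≡⟨ cong (walks i j +_) (sym (*-zeroʳ c)) ⟩
    walks i j + c * ⟦ false ⟧                ≡⟨ cong (λ s → walks i j + c * ⟦ s ⟧) (sym e) ⟩
    walks i j + c * ⟦ adj (res i) (res j) ⟧  ≡⟨ square-at i j ⟩
    μ                                        ∎))
  adjacent : ∀ i j → adj (res i) (res j) ≡ true → A²[ blowUp m K adj ] i j ≡ m * λ'
  adjacent i j e = trans (A²≡m*walks i j) (cong (m *_) (+-cancelʳ-≡ c _ _ (begin
    walks i j + c                            ≡⟨ cong (walks i j +_) (sym (*-identityʳ c)) ⟩
    walks i j + c * ⟦ true ⟧                 ≡⟨ cong (λ s → walks i j + c * ⟦ s ⟧) (sym e) ⟩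
    walks i j + c * ⟦ adj (res i) (res j) ⟧  ≡⟨ square-at i j ⟩
    μ                                        ≡⟨ sym λ'+c≡μ ⟩
    λ' + c                                   ∎)))

-- The seed, for r = r₀+1 layers, q − 1 = b a with b = b₀+1 and a = a₀+1.
module Seed (r₀ b₀ a₀ : ℕ) where
  r = suc r₀
  b = suc b₀
  a = suc a₀
  q = suc (b * a)

  -- gap p p' = p − p' − 1 (mod q); it is q − 1 = b a iff p = p'.
  gap : ℕ → ℕ → ℕ
  gap p p' = (p + (b * a ∸ p')) % q

  -- Arcs between (p,·,·) and (p',y',j') inside one layer (true) or across layers (false).
  arc : Bool → ℕ → ℕ → ℕ → ℕ → Bool
  arc true  p p' y' j' = gap p p' / a ≡ᵇ y'
  arc false p p' y' j' = (p + j') % q <ᵇ a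

  gap-block<b : ∀ p p' → p < q → p' < q → (gap p p' / a <ᵇ b) ≡ not (p ≡ᵇ p')
  gap-block<b p p' p<q p'<q with p ≟ p'
  ... | yes refl = begin
    gap p p / a <ᵇ b  ≡⟨ cong (λ z → z / a <ᵇ b) (cyclic-gap-self (b * a) p p<q) ⟩
    b * a / a <ᵇ b    ≡⟨ cong (_<ᵇ b) (m*n/n≡m b a) ⟩
    b <ᵇ b            ≡⟨ ≥⇒<ᵇ-false {b} ≤-refl ⟩
    false             ≡⟨ cong not (sym (≡ᵇ-refl p)) ⟩
    not (p ≡ᵇ p)      ∎
  ... | no p≢p' = trans (<⇒<ᵇ-true (m<n*o⇒m/o<n (cyclic-gap-other (b * a) p p' p<q p'<q p≢p')))
                        (cong not (sym (≢⇒≡ᵇ-false p≢p')))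

  arc-loopless : ∀ p y j → p < q → y < b → arc true p p y j ≡ false
  arc-loopless p y j p<q y<b = begin
    gap p p / a ≡ᵇ y  ≡⟨ cong (λ z → z / a ≡ᵇ y) (cyclic-gap-self (b * a) p p<q) ⟩
    b * a / a ≡ᵇ y    ≡⟨ cong (_≡ᵇ y) (m*n/n≡m b a) ⟩
    b ≡ᵇ y            ≡⟨ ≢⇒≡ᵇ-false (λ e → <-irrefl (sym e) y<b) ⟩
    false             ∎

  a≤q : a ≤ q
  a≤q = ≤-trans (m≤n*m a b) (n≤1+n (b * a))

  arc-colCount : ∀ s p' y' j' → y' < b → sumTo q (λ p → ⟦ arc s p p' y' j' ⟧) ≡ a
  arc-colCount true  p' y' j' y'<b =
    trans (sumTo-rotate q (b * a ∸ p') (λ z → ⟦ z / a ≡ᵇ y' ⟧)) (count-quotient b a y' y'<b)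
  arc-colCount false p' y' j' _ =
    trans (sumTo-rotate q j' (λ z → ⟦ z <ᵇ a ⟧)) (count-<ᵇ q a a≤q)

  cross-rowCount : ∀ p p' y' → sumTo q (λ j' → ⟦ arc false p p' y' j' ⟧) ≡ a
  cross-rowCount p p' y' =
    trans (sumTo-cong q (λ j' → cong (λ z → ⟦ z % q <ᵇ a ⟧) (+-comm p j')))
          (trans (sumTo-rotate q p (λ z → ⟦ z <ᵇ a ⟧)) (count-<ᵇ q a a≤q))

  same-rowCount : ∀ p p' j' → p < q → p' < q → sumTo b (λ y' → ⟦ arc true p p' y' j' ⟧) ≡ ⟦ not (p ≡ᵇ p') ⟧
  same-rowCount p p' j' p<q p'<q = trans (count-≡ᵇ b (gap p p' / a)) (cong ⟦_⟧ (gap-block<b p p' p<q p'<q))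

  weighted : Bool → ℕ → (ℕ → ℕ) → ℕ
  weighted s p Φ = sumTo q λ p₁ → sumTo b λ y₁ → sumTo q λ j₁ → ⟦ arc s p p₁ y₁ j₁ ⟧ * Φ p₁

  -- Inside a layer: X(Φ) + qΦ(p) = q ΣΦ, as p reaches each p₁ ≠ p in exactly q ways.
  same-weighted : ∀ p Φ → p < q → weighted true p Φ + q * Φ p ≡ q * sumTo q Φ
  same-weighted p Φ p<q = begin
    weighted true p Φ + q * Φ p
      ≡⟨ cong (_+ q * Φ p) (sumTo-cong< q fibre) ⟩
    sumTo q (λ p₁ → q * (⟦ not (p ≡ᵇ p₁) ⟧ * Φ p₁)) + q * Φ p
      ≡⟨ cong (_+ q * Φ p) (sumTo-*ˡ q q (λ p₁ → ⟦ not (p ≡ᵇ p₁) ⟧ * Φ p₁)) ⟩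
    q * sumTo q (λ p₁ → ⟦ not (p ≡ᵇ p₁) ⟧ * Φ p₁) + q * Φ p
      ≡⟨ sym (*-distribˡ-+ q (sumTo q (λ p₁ → ⟦ not (p ≡ᵇ p₁) ⟧ * Φ p₁)) (Φ p)) ⟩
    q * (sumTo q (λ p₁ → ⟦ not (p ≡ᵇ p₁) ⟧ * Φ p₁) + Φ p)
      ≡⟨ cong (q *_) (sumTo-omit q p Φ p<q) ⟩
    q * sumTo q Φ ∎
    where
    fibre : ∀ p₁ → p₁ < q →
            sumTo b (λ y₁ → sumTo q (λ j₁ → ⟦ arc true p p₁ y₁ j₁ ⟧ * Φ p₁)) ≡ q * (⟦ not (p ≡ᵇ p₁) ⟧ * Φ p₁)
    fibre p₁ p₁<q = begin
      sumTo b (λ y₁ → sumTo q (λ _ → ⟦ arc true p p₁ y₁ 0 ⟧ * Φ p₁))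
        ≡⟨ sumTo-cong b (λ y₁ → sumTo-const q (⟦ arc true p p₁ y₁ 0 ⟧ * Φ p₁)) ⟩
      sumTo b (λ y₁ → q * (⟦ arc true p p₁ y₁ 0 ⟧ * Φ p₁))
        ≡⟨ sumTo-*ˡ b q (λ y₁ → ⟦ arc true p p₁ y₁ 0 ⟧ * Φ p₁) ⟩
      q * sumTo b (λ y₁ → ⟦ arc true p p₁ y₁ 0 ⟧ * Φ p₁)
        ≡⟨ cong (q *_) (sumTo-*ʳ b (Φ p₁) (λ y₁ → ⟦ arc true p p₁ y₁ 0 ⟧)) ⟩
      q * (sumTo b (λ y₁ → ⟦ arc true p p₁ y₁ 0 ⟧) * Φ p₁)
        ≡⟨ cong (λ z → q * (z * Φ p₁)) (same-rowCount p p₁ 0 p<q p₁<q) ⟩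
      q * (⟦ not (p ≡ᵇ p₁) ⟧ * Φ p₁) ∎

  -- Across layers: Z(Φ) = b a ΣΦ, as p reaches each p₁ in exactly b a ways.
  cross-weighted : ∀ p Φ → weighted false p Φ ≡ b * (a * sumTo q Φ)
  cross-weighted p Φ = begin
    weighted false p Φ
      ≡⟨ sumTo-cong q (λ p₁ → sumTo-cong b (λ y₁ →
           trans (sumTo-*ʳ q (Φ p₁) (λ j₁ → ⟦ arc false p p₁ y₁ j₁ ⟧))
                 (cong (_* Φ p₁) (cross-rowCount p p₁ y₁)))) ⟩
    sumTo q (λ p₁ → sumTo b (λ _ → a * Φ p₁))
      ≡⟨ sumTo-cong q (λ p₁ → sumTo-const b (a * Φ p₁)) ⟩
    sumTo q (λ p₁ → b * (a * Φ p₁))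
      ≡⟨ trans (sumTo-*ˡ q b (λ p₁ → a * Φ p₁)) (cong (b *_) (sumTo-*ˡ q a Φ)) ⟩
    b * (a * sumTo q Φ) ∎

  walks : Bool → Bool → ℕ → ℕ → ℕ → ℕ → ℕ
  walks s t p p' y' j' = weighted s p (λ p₁ → ⟦ arc t p₁ p' y' j' ⟧)

  -- W = ba², the common value of the entries of ZX and ZZ.
  W : ℕ
  W = b * (a * a)

  same-walks : ∀ t p p' y' j' → p < q → y' < b → walks true t p p' y' j' + q * ⟦ arc t p p' y' j' ⟧ ≡ q * a
  same-walks t p p' y' j' p<q y'<b =
    trans (same-weighted p (λ p₁ → ⟦ arc t p₁ p' y' j' ⟧) p<q) (cong (q *_) (arc-colCount t p' y' j' y'<b))

  cross-walks : ∀ t p p' y' j' → y' < b → walks false t p p' y' j' ≡ W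
  cross-walks t p p' y' j' y'<b =
    trans (cross-weighted p (λ p₁ → ⟦ arc t p₁ p' y' j' ⟧)) (cong (λ z → b * (a * z)) (arc-colCount t p' y' j' y'<b))

  μ₀ : ℕ
  μ₀ = q * a + r₀ * W

  -- Target vertex in the same layer as the source: XX + (r−1)·ZZ + qX = qa + (r−1)W.
  walks-same-layer : ∀ g p p' y' j' → g < r → p < q → y' < b →
    sumTo r (λ g₁ → walks (g ≡ᵇ g₁) (g₁ ≡ᵇ g) p p' y' j') + q * ⟦ arc true p p' y' j' ⟧ ≡ μ₀
  walks-same-layer g p p' y' j' g<r p<q y'<b = begin
    sumTo r (λ g₁ → F (g ≡ᵇ g₁) (g₁ ≡ᵇ g)) + X
      ≡⟨ cong (_+ X) (layerSum-same r₀ g F g<r) ⟩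
    F true true + r₀ * F false false + X
      ≡⟨ +-right-comm (F true true) (r₀ * F false false) X ⟩
    F true true + X + r₀ * F false false
      ≡⟨ cong₂ (λ x z → x + r₀ * z) (same-walks true p p' y' j' p<q y'<b) (cross-walks false p p' y' j' y'<b) ⟩
    μ₀ ∎
    where
    F : Bool → Bool → ℕ
    F s t = walks s t p p' y' j'
    X : ℕ
    X = q * ⟦ arc true p p' y' j' ⟧
    +-right-comm : ∀ x y z → x + y + z ≡ x + z + y
    +-right-comm = solve-∀

  -- Target vertex in another layer: XZ + ZX + (r−2)·ZZ + qZ = qa + (r−1)W.
  walks-other-layer : ∀ g g' p p' y' j' → g < r → g' < r → g ≢ g' → p < q → y' < b →
    sumTo r (λ g₁ → walks (g ≡ᵇ g₁) (g₁ ≡ᵇ g') p p' y' j') + q * ⟦ arc false p p' y' j' ⟧ ≡ μ₀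
  walks-other-layer g g' p p' y' j' g<r g'<r g≢g' p<q y'<b = +-cancelʳ-≡ W _ _ (begin
    S + Z + W
      ≡⟨ cong (S + Z +_) (sym (cross-walks false p p' y' j' y'<b)) ⟩
    S + Z + F false false
      ≡⟨ +-right-comm S Z (F false false) ⟩
    S + F false false + Z
      ≡⟨ cong (_+ Z) (layerSum-other r₀ g g' F g<r g'<r g≢g') ⟩
    F true false + F false true + r₀ * F false false + Z
      ≡⟨ regroup (F true false) (F false true) (r₀ * F false false) Z ⟩
    F true false + Z + r₀ * F false false + F false true
      ≡⟨ cong (λ x → x + r₀ * F false false + F false true) (same-walks false p p' y' j' p<q y'<b) ⟩
    q * a + r₀ * F false false + F false true
      ≡⟨ cong₂ (λ z w → q * a + r₀ * z + w) (cross-walks false p p' y' j' y'<b) (cross-walks true p p' y' j' y'<b) ⟩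
    μ₀ + W ∎)
    where
    F : Bool → Bool → ℕ
    F s t = walks s t p p' y' j'
    S Z : ℕ
    S = sumTo r (λ g₁ → F (g ≡ᵇ g₁) (g₁ ≡ᵇ g'))
    Z = q * ⟦ arc false p p' y' j' ⟧
    +-right-comm : ∀ x y z → x + y + z ≡ x + z + y
    +-right-comm = solve-∀
    regroup : ∀ x y z w → x + y + z + w ≡ x + w + z + y
    regroup = solve-∀

  walks-all-layers : ∀ g g' p p' y' j' → g < r → g' < r → p < q → y' < b →
    sumTo r (λ g₁ → walks (g ≡ᵇ g₁) (g₁ ≡ᵇ g') p p' y' j') + q * ⟦ arc (g ≡ᵇ g') p p' y' j' ⟧ ≡ μ₀
  walks-all-layers g g' p p' y' j' g<r g'<r p<q y'<b with g ≟ g'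
  ... | yes refl rewrite ≡ᵇ-refl g = walks-same-layer g p p' y' j' g<r p<q y'<b
  ... | no g≢g'  rewrite ≢⇒≡ᵇ-false g≢g' = walks-other-layer g g' p p' y' j' g<r g'<r g≢g' p<q y'<b

  out-per-layer : ∀ s p → p < q → sumTo q (λ p' → sumTo b (λ y' → sumTo q (λ j' → ⟦ arc s p p' y' j' ⟧))) ≡ q * (b * a)
  out-per-layer true p p<q = begin
    sumTo q (λ p' → sumTo b (λ y' → sumTo q (λ _ → ⟦ arc true p p' y' 0 ⟧)))
      ≡⟨ sumTo-cong< q (λ p' p'<q →
           trans (sumTo-cong b (λ y' → sumTo-const q ⟦ arc true p p' y' 0 ⟧))
                 (trans (sumTo-*ˡ b q (λ y' → ⟦ arc true p p' y' 0 ⟧)) (cong (q *_) (same-rowCount p p' 0 p<q p'<q)))) ⟩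
    sumTo q (λ p' → q * ⟦ not (p ≡ᵇ p') ⟧)
      ≡⟨ sumTo-*ˡ q q (λ p' → ⟦ not (p ≡ᵇ p') ⟧) ⟩
    q * sumTo q (λ p' → ⟦ not (p ≡ᵇ p') ⟧)
      ≡⟨ cong (q *_) (suc-injective (trans (+-comm 1 _) (count-others q p p<q))) ⟩
    q * (b * a) ∎
  out-per-layer false p _ =
    trans (sumTo-cong q (λ p' → trans (sumTo-cong b (λ y' → cross-rowCount p p' y')) (sumTo-const b a)))
          (sumTo-const q (b * a))

  in-per-layer : ∀ s p' y' j' → y' < b → sumTo q (λ p → sumTo b (λ y → sumTo q (λ j → ⟦ arc s p p' y' j' ⟧))) ≡ q * (b * a)
  in-per-layer s p' y' j' y'<b = begin
    sumTo q (λ p → sumTo b (λ _ → sumTo q (λ _ → ⟦ arc s p p' y' j' ⟧)))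
      ≡⟨ sumTo-cong q (λ p → trans (sumTo-const b (sumTo q (λ _ → ⟦ arc s p p' y' j' ⟧)))
                                   (cong (b *_) (sumTo-const q ⟦ arc s p p' y' j' ⟧))) ⟩
    sumTo q (λ p → b * (q * ⟦ arc s p p' y' j' ⟧))
      ≡⟨ trans (sumTo-*ˡ q b (λ p → q * ⟦ arc s p p' y' j' ⟧))
               (cong (b *_) (sumTo-*ˡ q q (λ p → ⟦ arc s p p' y' j' ⟧))) ⟩
    b * (q * sumTo q (λ p → ⟦ arc s p p' y' j' ⟧))
      ≡⟨ cong (λ z → b * (q * z)) (arc-colCount s p' y' j' y'<b) ⟩
    b * (q * a)
      ≡⟨ rearrange b q a ⟩
    q * (b * a) ∎
    where
    rearrange : ∀ x y z → x * (y * z) ≡ y * (x * z)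
    rearrange = solve-∀

  -- Vertices u < K encode (layer, p, y, j) in mixed radix (r, q, b, q).
  K Q₁ Q₂ : ℕ
  Q₂ = b * q
  Q₁ = q * Q₂
  K = r * Q₁

  layerOf posOf blockOf colOf : ℕ → ℕ
  layerOf u = u / Q₁
  posOf   u = (u % Q₁) / Q₂
  blockOf u = ((u % Q₁) % Q₂) / q
  colOf   u = ((u % Q₁) % Q₂) % q

  layerOf< : ∀ u → u < K → layerOf u < r
  layerOf< u u<K = m<n*o⇒m/o<n u<K
  posOf< : ∀ u → posOf u < q
  posOf< u = m<n*o⇒m/o<n (m%n<n u Q₁)
  blockOf< : ∀ u → blockOf u < b
  blockOf< u = m<n*o⇒m/o<n (m%n<n (u % Q₁) Q₂)

  sumTo-vertices : ∀ (H : ℕ → ℕ → ℕ → ℕ → ℕ) →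
    sumTo K (λ u → H (layerOf u) (posOf u) (blockOf u) (colOf u))
      ≡ sumTo r (λ g → sumTo q (λ p → sumTo b (λ y → sumTo q (λ j → H g p y j))))
  sumTo-vertices H =
    trans (sumTo-divmod r Q₁ (λ g u → H g (u / Q₂) ((u % Q₂) / q) ((u % Q₂) % q)))
          (sumTo-cong r (λ g → trans (sumTo-divmod q Q₂ (λ p u → H g p (u / q) (u % q)))
                                     (sumTo-cong q (λ p → sumTo-divmod b q (H g p)))))

  adj : ℕ → ℕ → Bool
  adj u v = arc (layerOf u ≡ᵇ layerOf v) (posOf u) (posOf v) (blockOf v) (colOf v)

  seed : IsSeed K (r * (q * (b * a))) q μ₀ adj
  seed = record { loopless = loopless ; outDegree = outDegree ; inDegree = inDegree ; square = square }
    where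
    loopless : ∀ u → u < K → adj u u ≡ false
    loopless u _ = trans (cong (λ s → arc s (posOf u) (posOf u) (blockOf u) (colOf u)) (≡ᵇ-refl (layerOf u)))
                         (arc-loopless (posOf u) (blockOf u) (colOf u) (posOf< u) (blockOf< u))

    outDegree : ∀ u → u < K → sumTo K (λ v → ⟦ adj u v ⟧) ≡ r * (q * (b * a))
    outDegree u _ = begin
      sumTo K (λ v → ⟦ adj u v ⟧)
        ≡⟨ sumTo-vertices (λ g' p' y' j' → ⟦ arc (layerOf u ≡ᵇ g') (posOf u) p' y' j' ⟧) ⟩
      sumTo r (λ g' → sumTo q (λ p' → sumTo b (λ y' → sumTo q (λ j' → ⟦ arc (layerOf u ≡ᵇ g') (posOf u) p' y' j' ⟧))))
        ≡⟨ sumTo-cong r (λ g' → out-per-layer (layerOf u ≡ᵇ g') (posOf u) (posOf< u)) ⟩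
      sumTo r (λ _ → q * (b * a))
        ≡⟨ sumTo-const r (q * (b * a)) ⟩
      r * (q * (b * a)) ∎

    inDegree : ∀ v → v < K → sumTo K (λ u → ⟦ adj u v ⟧) ≡ r * (q * (b * a))
    inDegree v _ = begin
      sumTo K (λ u → ⟦ adj u v ⟧)
        ≡⟨ sumTo-vertices (λ g p y j → ⟦ arc (g ≡ᵇ layerOf v) p (posOf v) (blockOf v) (colOf v) ⟧) ⟩
      sumTo r (λ g → sumTo q (λ p → sumTo b (λ y → sumTo q (λ j → ⟦ arc (g ≡ᵇ layerOf v) p (posOf v) (blockOf v) (colOf v) ⟧))))
        ≡⟨ sumTo-cong r (λ g → in-per-layer (g ≡ᵇ layerOf v) (posOf v) (blockOf v) (colOf v) (blockOf< v)) ⟩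
      sumTo r (λ _ → q * (b * a))
        ≡⟨ sumTo-const r (q * (b * a)) ⟩
      r * (q * (b * a)) ∎

    -- Decoding the middle vertex turns (A²)_uw into the layer sum of walks-all-layers.
    square : ∀ u w → u < K → w < K → sumTo K (λ v → ⟦ adj u v ⟧ * ⟦ adj v w ⟧) + q * ⟦ adj u w ⟧ ≡ μ₀
    square u w u<K w<K = trans
      (cong (_+ q * ⟦ adj u w ⟧) (sumTo-vertices (λ g₁ p₁ y₁ j₁ →
         ⟦ arc (layerOf u ≡ᵇ g₁) (posOf u) p₁ y₁ j₁ ⟧ * ⟦ arc (g₁ ≡ᵇ layerOf w) p₁ (posOf w) (blockOf w) (colOf w) ⟧)))
      (walks-all-layers (layerOf u) (layerOf w) (posOf u) (posOf w) (blockOf w) (colOf w)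
         (layerOf< u u<K) (layerOf< w w<K) (posOf< u) (blockOf< w))

  -- The seed parameters in the closed forms of the theorem, where q − 1 = b a,
  -- a − 1 = a₀ and r − 1 = r₀.
  λ₀ : ℕ
  λ₀ = q * a₀ + r₀ * (b * a) * a

  λ₀+q≡μ₀ : λ₀ + q ≡ μ₀
  λ₀+q≡μ₀ = identity q a₀ r₀ b
    where
    identity : ∀ q a₀ r₀ b → q * a₀ + r₀ * (b * suc a₀) * suc a₀ + q ≡ q * suc a₀ + r₀ * (b * (suc a₀ * suc a₀))
    identity = solve-∀

  μ₀-closed : μ₀ ≡ r * q * a ∸ r * a + a
  μ₀-closed = begin
    μ₀                                  ≡⟨ identity₁ r₀ b a ⟩
    r * (b * a) * a + a                 ≡⟨ cong (_+ a) (sym (m+n∸m≡n (r * a) _)) ⟩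
    r * a + r * (b * a) * a ∸ r * a + a ≡⟨ cong (λ z → z ∸ r * a + a) (identity₂ r (b * a) a) ⟩
    r * q * a ∸ r * a + a               ∎
    where
    identity₁ : ∀ r₀ b a → suc (b * a) * a + r₀ * (b * (a * a)) ≡ suc r₀ * (b * a) * a + a
    identity₁ = solve-∀
    identity₂ : ∀ r x a → r * a + r * x * a ≡ r * suc x * a
    identity₂ = solve-∀

  blowUp-size : ∀ m → m * K ≡ (m * r * q ^ 2 * (b * a)) / a
  blowUp-size m = sym (begin
    (m * r * q ^ 2 * (b * a)) / a  ≡⟨ /-congˡ (regroup (m * r * q ^ 2) b a) ⟩
    (m * r * q ^ 2 * b * a) / a    ≡⟨ m*n/n≡m (m * r * q ^ 2 * b) a ⟩
    m * r * q ^ 2 * b              ≡⟨ cong (λ z → m * r * (q * z) * b) (*-identityʳ q) ⟩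
    m * r * (q * q) * b            ≡⟨ identity m r q b ⟩
    m * K                          ∎)
    where
    regroup : ∀ x y z → x * (y * z) ≡ x * y * z
    regroup = solve-∀
    identity : ∀ m r q b → m * r * (q * q) * b ≡ m * (r * (q * (b * q)))
    identity = solve-∀

  blowUp-degree : ∀ m → m * (r * (q * (b * a))) ≡ m * r * q * (b * a)
  blowUp-degree m = identity m r q (b * a)
    where
    identity : ∀ m r q x → m * (r * (q * x)) ≡ m * r * q * x
    identity = solve-∀

castDSRG : ∀ {v v' k k' t t' l l' μ μ'} → v ≡ v' → k ≡ k' → t ≡ t' → l ≡ l' → μ ≡ μ' →
           Σ (Digraph v) (IsDSRG v k t l μ) → Σ (Digraph v') (IsDSRG v' k' t' l' μ')
castDSRG refl refl refl refl refl G = G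

mainTheorem3 : (r q a : ℕ) → 1 < r → 1 < q → 1 < a → a ∣ (q ∸ 1) → .{{_ : NonZero a}} → 1 < (q ∸ 1) / a →
    (m : ℕ) → 0 < m →
    Σ (Digraph ((m * r * q ^ 2 * (q ∸ 1)) / a)) λ A →
      IsDSRG ((m * r * q ^ 2 * (q ∸ 1)) / a)
             (m * r * q * (q ∸ 1))
             (m * (r * q * a ∸ r * a + a))
             (m * (q * (a ∸ 1) + (r ∸ 1) * (q ∸ 1) * a))
             (m * (r * q * a ∸ r * a + a))
             A
mainTheorem3 (suc r₀) (suc .(suc b₀ * suc a₀)) (suc a₀) _ _ _ (divides (suc b₀) refl) _ m _ =
  castDSRG (blowUp-size m) (blowUp-degree m) (cong (m *_) μ₀-closed) refl (cong (m *_) μ₀-closed)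
           (blowUp m K adj , blowUp-isDSRG seed λ₀+q≡μ₀ m)
  where open Seed r₀ b₀ a₀
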